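{- Let $\mathcal C$ be a finite set and let $L$ and $L'$ be two linear orderings of $\mathcal C$. The following three conditions are equivalent: (A) there exist alternatives $i,j,k\in\mathcal C$ such that (a) $i>_L k$, $j>_L k$, $i>_{L'}k$ and $j>_{L'}k$; (b) $i\neq j$; (c) $L^-(k)\neq L'^-(k)$; (d) $L^-(i)=L'^-(j)$; (B) there exists a subset $U$ with $\varnothing\neq U\subsetneq\mathcal C$ such that ($\alpha$) $U$ is a beginning set of both $L$ and $L'$, and ($\beta$) $L$ and $L'$ do not coincide on $U$ and do not coincide on $\mathcal C\setminus U$; (C) the vertices $p^L$ and $p^{L'}$ of the multiple choice polytope $\mathcal P_{MC}(\mathcal C)$ are not adjacent.
   Context: For a linear ordering $L$ of $\mathcal C$ and $i\in\mathcal C$, $L^-(i)=\{j\in\mathcal C: j\ge_L i\}$; a beginning set of $L$ is a set of this form. Two linear orderings coincide on a subset $S$ if their restrictions to $S$ are equal. Let $E=\{(i,S): i\in S\subseteq\mathcal C\}$; $p^L\in\mathbb R^E$ is given by $p^L(i,S)=1$ if $i>_L j$ for all $j\in S\setminus\{i\}$ and $0$ otherwise. The multiple choice polytope $\mathcal P_{MC}(\mathcal C)$ is the convex hull of all $p^L$, whose vertices are exactly the $p^L$. Two vertices are adjacent if the segment joining them is a face of the polytope.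
   Formalization: The multiple choice polytope, the segment joining $p^L$ and $p^{L'}$ and the inequalities exposing it as a face are taken in ℚ^E instead of $\mathbb R^E$. -}

module Defs where

open import Data.Nat using (ℕ; zero; suc)
open import Data.Bool using (Bool; true; false; if_then_else_; _∧_; _∨_; not)
open import Data.Fin using (Fin; _≟_)
import Data.Fin as F
open import Data.Fin.Properties using (_≤?_; _<?_)
open import Data.Fin.Subset using (Subset; _∈_; _∉_; ∁; ⊤)
open import Data.Vec using (Vec; []; _∷_; lookup; tabulate)
open import Data.List using (List; []; _∷_; map; _++_; foldr; allFin)
open import Data.Product using (Σ; ∃; _×_; _,_; proj₁; proj₂)
open import Data.Rational using (ℚ; 0ℚ; 1ℚ; _+_; _*_; _-_; _≤_)
open import Function.Definitions using (Injective)
open import Function.Bundles using (_⇔_)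
open import Relation.Binary.PropositionalEquality using (_≡_; _≢_)
open import Relation.Nullary.Decidable using (⌊_⌋)

-- A linear ordering of Fin n is given by an injective (hence bijective) rank
-- function; i >_L j  iff  rank j < rank i.  Distinct rank functions give
-- distinct orderings, so this is a faithful encoding of linear orderings.
record LinOrd (n : ℕ) : Set where
  field
    rank : Fin n → Fin n
    rank-inj : Injective _≡_ _≡_ rank
open LinOrd public

_>[_]_ : {n : ℕ} → Fin n → LinOrd n → Fin n → Set
i >[ L ] j = rank L j F.< rank L i

L⁻ : {n : ℕ} → LinOrd n → Fin n → Subset n
L⁻ L i = tabulate (λ j → ⌊ rank L i ≤? rank L j ⌋)

IsBeginning : {n : ℕ} → LinOrd n → Subset n → Set
IsBeginning L U = ∃ λ i → U ≡ L⁻ L i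

CoincideOn : {n : ℕ} → LinOrd n → LinOrd n → Subset n → Set
CoincideOn L L' S =
  ∀ i j → i ∈ S → j ∈ S → (i >[ L ] j ⇔ i >[ L' ] j)

allSubsets : (n : ℕ) → List (Subset n)
allSubsets zero = [] ∷ []
allSubsets (suc n) = map (true ∷_) (allSubsets n) ++ map (false ∷_) (allSubsets n)

-- vectors in ℚ^E, E = {(i,S) : i ∈ S}; coordinates with i ∉ S are ignored
QVec : ℕ → Set
QVec n = Fin n → Subset n → ℚ

_≈E_ : {n : ℕ} → QVec n → QVec n → Set
x ≈E y = ∀ i S → i ∈ S → x i S ≡ y i S

sumℚ : List ℚ → ℚ
sumℚ = foldr _+_ 0ℚ

dot : {n : ℕ} → QVec n → QVec n → ℚ
dot {n} c x = sumℚ (Data.List.concatMap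
  (λ i → map (λ S → if lookup S i then c i S * x i S else 0ℚ) (allSubsets n))
  (allFin n))

allᵇ : {A : Set} → (A → Bool) → List A → Bool
allᵇ f = foldr (λ a b → f a ∧ b) true

p : {n : ℕ} → LinOrd n → QVec n
p {n} L i S =
  if allᵇ (λ j → not (lookup S j) ∨ ⌊ j ≟ i ⌋ ∨ ⌊ rank L j <? rank L i ⌋) (allFin n)
  then 1ℚ else 0ℚ

scale : {n : ℕ} → ℚ → QVec n → QVec n
scale t x i S = t * x i S

_⊕_ : {n : ℕ} → QVec n → QVec n → QVec n
(x ⊕ y) i S = x i S + y i S

zeroV : {n : ℕ} → QVec n
zeroV i S = 0ℚ

InPMC : {n : ℕ} → QVec n → Set
InPMC {n} x = Σ (List (ℚ × LinOrd n)) λ ws →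
  Data.List.Relation.Unary.All.All (λ w → 0ℚ ≤ proj₁ w) ws ×
  sumℚ (map proj₁ ws) ≡ 1ℚ ×
  x ≈E foldr (λ w acc → scale (proj₁ w) (p (proj₂ w)) ⊕ acc) zeroV ws
  where import Data.List.Relation.Unary.All

InSegment : {n : ℕ} → LinOrd n → LinOrd n → QVec n → Set
InSegment L L' x = Σ ℚ λ t → 0ℚ ≤ t × t ≤ 1ℚ ×
  x ≈E (scale t (p L) ⊕ scale (1ℚ - t) (p L'))

-- p^L and p^L' are adjacent: the segment joining them is a face of P_MC,
-- i.e. it is cut out of P_MC by a valid linear inequality c·x ≤ d.
Adjacent : {n : ℕ} → LinOrd n → LinOrd n → Set
Adjacent {n} L L' = Σ (QVec n) λ c → Σ ℚ λ d →
  (∀ x → InPMC x → dot c x ≤ d) ×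
  (∀ x → InPMC x → (dot c x ≡ d ⇔ InSegment L L' x))

CondA : {n : ℕ} → LinOrd n → LinOrd n → Set
CondA L L' = ∃ λ i → ∃ λ j → ∃ λ k →
  (i >[ L ] k × j >[ L ] k × i >[ L' ] k × j >[ L' ] k) ×
  i ≢ j ×
  L⁻ L k ≢ L⁻ L' k ×
  L⁻ L i ≡ L⁻ L' j

CondB : {n : ℕ} → LinOrd n → LinOrd n → Set
CondB {n} L L' = Σ (Subset n) λ U →
  (∃ λ i → i ∈ U) × (∃ λ i → i ∉ U) ×
  (IsBeginning L U × IsBeginning L' U) ×
  ((CoincideOn L L' U → Data.Empty.⊥) × (CoincideOn L L' (∁ U) → Data.Empty.⊥))
  where import Data.Empty

CondC : {n : ℕ} → LinOrd n → LinOrd n → Set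
CondC L L' = Adjacent L L' → Data.Empty.⊥
  where import Data.Empty

{-# OPTIONS --safe #-}
module Submission where

-- (A) ⇔ (B) is order combinatorics: given U as in (B), let i be the L-least element of U at
-- which L and L' have different lower sets; then L⁻ L i is also a beginning set of L'.
--
-- For (B) ⇔ (C), let μ_X(i,S) = (-1)^|S ∖ D| if S ⊇ D and 0 otherwise, where D = {j : j ≤_X i}.
-- By inclusion–exclusion ⟨μ_X, p^M⟩ is the number of i at which M and X have the same lower
-- set. So ⟨μ_L + μ_L', ·⟩ is maximal on the polytope exactly at the p^M for which M agrees
-- with L or with L' at every i. Without a set U as in (B) such an M agrees with L everywhere
-- or with L' everywhere, so this functional cuts out the segment [p^L, p^L']. Conversely,
-- given U, glue L on U above L' off U, and L' on U above L off U: the glued orders M, M'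
-- satisfy p^M + p^M' = p^L + p^L', so every face containing the segment contains p^M; yet
-- p^M equals p^L at a coordinate where p^L ≠ p^L', and p^L' at another such coordinate.

open import Defs
open import Data.Nat using (ℕ; zero; suc)
import Data.Nat as ℕ
import Data.Nat.Properties as ℕ
open import Data.Bool using (Bool; true; false; if_then_else_; not; _∧_; _∨_)
import Data.Bool
open import Data.Fin using (Fin; _≟_; toℕ; fromℕ<)
import Data.Fin as Fin
import Data.Fin.Properties as Fin
open import Data.Fin.Properties using (any?; all?; ¬∀⟶∃¬)
open import Data.Fin.Subset using (Subset; _∈_; _∉_; _⊂_; ∁; ∣_∣)
open import Data.Fin.Subset.Properties
  using (_∈?_; anySubset?; ⊆-antisym; x∈∁p⇒x∉p; x∉p⇒x∈∁p; ∈⊤; ∣⊤∣≡n)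
open import Data.Fin.Subset.Properties using (p⊂q⇒∣p∣<∣q∣; p⊆q⇒∣p∣≤∣q∣)
open import Data.Vec using (_∷_; lookup; tabulate)
import Data.Vec.Properties as Vec
open import Data.Vec.Properties using (lookup∘tabulate; lookup⇒[]=; []=⇒lookup)
open import Data.List using (List; []; _∷_; map; _++_; foldr; concatMap; allFin; filter)
import Data.List as List
import Data.List.Properties as List
import Data.List.Extrema as Extrema
open import Data.List.Relation.Unary.All using (All; []; _∷_)
import Data.List.Relation.Unary.All as All
open import Data.List.Relation.Unary.All.Properties using (all-filter)
open import Data.List.Membership.Propositional.Properties using (∈-allFin; ∈-filter⁺)
open import Data.Rational using (ℚ; 0ℚ; 1ℚ; ½; _+_; _*_; _-_; -_; _≤_; _<_; positive; nonNegative)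
import Data.Rational.Properties as ℚ
open import Data.Rational.Solver using (module +-*-Solver)
open import Data.Product using (Σ; ∃; _×_; _,_; proj₁; proj₂)
open import Data.Sum using (_⊎_; inj₁; inj₂; [_,_]′)
import Data.Sum as Sum
open import Data.Empty using (⊥; ⊥-elim)
open import Function using (_∘_; id)
open import Function.Definitions using (Injective)
open import Function.Bundles using (_⇔_; mk⇔; Equivalence)
import Function.Properties.Equivalence as ⇔
open Equivalence using (to; from)
open import Relation.Unary using (Decidable)
open import Relation.Nullary using (¬_; Dec; yes; no; ¬?; contradiction)
open import Relation.Nullary.Decidable using (⌊_⌋; _×-dec_; _→-dec_; decidable-stable; from-yes)
import Relation.Nullary.Decidable as Dec
open import Relation.Binary.Definitions using (tri<; tri≈; tri>)
open import Relation.Binary.PropositionalEquality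
open import Algebra.Properties.CommutativeMonoid.Sum ℚ.*-1-commutativeMonoid
  using () renaming (sum to ∏; sum-cong-≗ to ∏-cong; ∑-distrib-+ to ∏-distrib-*)
open +-*-Solver

_⇔?_ : {A B : Set} → Dec A → Dec B → Dec (A ⇔ B)
a? ⇔? b? = Dec.map′ (λ (f , g) → mk⇔ f g) (λ e → to e , from e) ((a? →-dec b?) ×-dec (b? →-dec a?))

⌊⌋-⇔ : {A B : Set} → A ⇔ B → (a? : Dec A) (b? : Dec B) → ⌊ a? ⌋ ≡ ⌊ b? ⌋
⌊⌋-⇔ A⇔B a? b? =
  trans (Dec.isYes≗does a?) (trans (Dec.does-⇔ A⇔B a? b?) (sym (Dec.isYes≗does b?)))

∈-tabulate : {n : ℕ} {P : Fin n → Set} (P? : Decidable P) {z : Fin n} →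
             z ∈ tabulate (λ j → ⌊ P? j ⌋) ⇔ P z
∈-tabulate {P = P} P? {z} = mk⇔ sound complete
  where
  lookup-tabulate : lookup (tabulate (λ j → ⌊ P? j ⌋)) z ≡ Dec.does (P? z)
  lookup-tabulate = trans (lookup∘tabulate (λ j → ⌊ P? j ⌋) z) (Dec.isYes≗does (P? z))
  sound : z ∈ tabulate (λ j → ⌊ P? j ⌋) → P z
  sound z∈ with P? z | trans (sym lookup-tabulate) ([]=⇒lookup z∈)
  ... | yes pz | _ = pz
  complete : P z → z ∈ tabulate (λ j → ⌊ P? j ⌋)
  complete pz = lookup⇒[]= z _ (trans lookup-tabulate (Dec.dec-true (P? z) pz))

module _ {n : ℕ} where

  _>[_]?_ : (i : Fin n) (X : LinOrd n) (j : Fin n) → Dec (i >[ X ] j)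
  i >[ X ]? j = rank X j Fin.<? rank X i

  >-irrefl : (X : LinOrd n) {i : Fin n} → ¬ i >[ X ] i
  >-irrefl X = Fin.<-irrefl refl

  >-asym : (X : LinOrd n) {i j : Fin n} → i >[ X ] j → ¬ j >[ X ] i
  >-asym X = Fin.<-asym

  >-trans : (X : LinOrd n) {i j k : Fin n} → i >[ X ] j → j >[ X ] k → i >[ X ] k
  >-trans X i>j j>k = Fin.<-trans j>k i>j

  ≯-antisym : (X : LinOrd n) {i j : Fin n} → ¬ i >[ X ] j → ¬ j >[ X ] i → i ≡ j
  ≯-antisym X i≯j j≯i = rank-inj X (Fin.≤-antisym (ℕ.≮⇒≥ i≯j) (ℕ.≮⇒≥ j≯i))

  >-connex : (X : LinOrd n) {i j : Fin n} → i ≢ j → i >[ X ] j ⊎ j >[ X ] i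
  >-connex X {i} {j} i≢j with i >[ X ]? j | j >[ X ]? i
  ... | yes i>j | _       = inj₁ i>j
  ... | no _    | yes j>i = inj₂ j>i
  ... | no i≯j  | no j≯i  = contradiction (≯-antisym X i≯j j≯i) i≢j

  ≯->-trans : (X : LinOrd n) {i a b : Fin n} → ¬ i >[ X ] a → i >[ X ] b → a >[ X ] b
  ≯->-trans X i≯a i>b = ℕ.<-≤-trans i>b (ℕ.≮⇒≥ i≯a)

  ∈L⁻⇔≯ : (X : LinOrd n) {i j : Fin n} → j ∈ L⁻ X i ⇔ (¬ i >[ X ] j)
  ∈L⁻⇔≯ X {i} = ⇔.trans (∈-tabulate (λ j → rank X i Fin.≤? rank X j)) (mk⇔ ℕ.≤⇒≯ ℕ.≮⇒≥)

  ∈L⁻-refl : (X : LinOrd n) {i : Fin n} → i ∈ L⁻ X i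
  ∈L⁻-refl X = from (∈L⁻⇔≯ X) (>-irrefl X)

  L⁻-injective : (X : LinOrd n) {i j : Fin n} → L⁻ X i ≡ L⁻ X j → i ≡ j
  L⁻-injective X {i} {j} eq = ≯-antisym X (to (∈L⁻⇔≯ X) (subst (j ∈_) (sym eq) (∈L⁻-refl X)))
                                          (to (∈L⁻⇔≯ X) (subst (i ∈_) eq (∈L⁻-refl X)))

  record AgreeAt (X Y : LinOrd n) (i : Fin n) : Set where
    constructor mkAgreeAt
    field below⇔ : ∀ j → i >[ X ] j ⇔ i >[ Y ] j

  open AgreeAt public

  AgreeAt? : (X Y : LinOrd n) (i : Fin n) → Dec (AgreeAt X Y i)
  AgreeAt? X Y i = Dec.map′ mkAgreeAt below⇔ (all? λ j → (i >[ X ]? j) ⇔? (i >[ Y ]? j))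

  agreeAt-refl : (X : LinOrd n) {i : Fin n} → AgreeAt X X i
  agreeAt-refl X = mkAgreeAt λ _ → ⇔.refl

  agreeAt-sym : {X Y : LinOrd n} {i : Fin n} → AgreeAt X Y i → AgreeAt Y X i
  agreeAt-sym a = mkAgreeAt λ j → ⇔.sym (below⇔ a j)

  agreeAt-trans : {X Y Z : LinOrd n} {i : Fin n} → AgreeAt X Y i → AgreeAt Y Z i → AgreeAt X Z i
  agreeAt-trans a b = mkAgreeAt λ j → ⇔.trans (below⇔ a j) (below⇔ b j)

  agreeAt-above : (X Y : LinOrd n) {v z : Fin n} → AgreeAt X Y v → z >[ X ] v → z >[ Y ] v
  agreeAt-above X Y {v} {z} a z>v with >-connex Y {z} {v} (λ { refl → >-irrefl X z>v })
  ... | inj₁ z>Yv = z>Yv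
  ... | inj₂ v>Yz = contradiction (from (below⇔ a z) v>Yz) (>-asym X z>v)

  agreeAt⇔L⁻≡ : (X Y : LinOrd n) {i : Fin n} → AgreeAt X Y i ⇔ L⁻ X i ≡ L⁻ Y i
  agreeAt⇔L⁻≡ X Y {i} = mk⇔ (λ a → ⊆-antisym (L⁻-⊆ X Y a) (L⁻-⊆ Y X (agreeAt-sym a)))
                            (λ eq → mkAgreeAt λ j → mk⇔ (L⁻-≡⇒> X Y eq) (L⁻-≡⇒> Y X (sym eq)))
    where
    L⁻-⊆ : (X Y : LinOrd n) → AgreeAt X Y i → ∀ {j} → j ∈ L⁻ X i → j ∈ L⁻ Y i
    L⁻-⊆ X Y a {j} j∈ = from (∈L⁻⇔≯ Y) (λ i>Yj → to (∈L⁻⇔≯ X) j∈ (from (below⇔ a j) i>Yj))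
    L⁻-≡⇒> : (X Y : LinOrd n) → L⁻ X i ≡ L⁻ Y i → ∀ {j} → i >[ X ] j → i >[ Y ] j
    L⁻-≡⇒> X Y eq {j} i>Xj = decidable-stable (i >[ Y ]? j) λ i≯Yj →
      to (∈L⁻⇔≯ X) (subst (j ∈_) (sym eq) (from (∈L⁻⇔≯ Y) i≯Yj)) i>Xj

  Separated : LinOrd n → Subset n → Set
  Separated X U = ∀ {z z'} → z ∈ U → z' ∉ U → z >[ X ] z'

  beginning⇒separated : (X : LinOrd n) {U : Subset n} → IsBeginning X U → Separated X U
  beginning⇒separated X (u , refl) {z} {z'} z∈ z'∉ =
    ≯->-trans X (to (∈L⁻⇔≯ X) z∈) (decidable-stable (u >[ X ]? z') (z'∉ ∘ from (∈L⁻⇔≯ X)))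

  separated⇒upward-closed : (X : LinOrd n) {U : Subset n} → Separated X U →
                            ∀ {a b} → a ∈ U → ¬ a >[ X ] b → b ∈ U
  separated⇒upward-closed X sep {a} {b} a∈ a≯b = decidable-stable (b ∈? _) (a≯b ∘ sep a∈)

  module _ (X : LinOrd n) {P : Fin n → Set} (P? : Decidable P) where
    open Extrema (Fin.≤-totalOrder n)

    least : ∃ P → ∃ λ w → P w × (∀ {z} → P z → ¬ w >[ X ] z)
    least (z₀ , pz₀) = w , argmin-all (rank X) pz₀ (all-filter P? (allFin n)) , minimal
      where
      w = argmin (rank X) z₀ (filter P? (allFin n))
      minimal : ∀ {z} → P z → ¬ w >[ X ] z
      minimal {z} pz = ℕ.≤⇒≯ (All.lookup (f[argmin]≤f[xs] z₀ _) (∈-filter⁺ P? (∈-allFin z) pz))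

    greatest : ∃ P → ∃ λ w → P w × (∀ {z} → P z → ¬ z >[ X ] w)
    greatest (z₀ , pz₀) = w , argmax-all (rank X) pz₀ (all-filter P? (allFin n)) , maximal
      where
      w = argmax (rank X) z₀ (filter P? (allFin n))
      maximal : ∀ {z} → P z → ¬ z >[ X ] w
      maximal {z} pz = ℕ.≤⇒≯ (All.lookup (f[xs]≤f[argmax] z₀ _) (∈-filter⁺ P? (∈-allFin z) pz))

  upward-closed⇒beginning : (X : LinOrd n) (T : Subset n) {x : Fin n} → x ∈ T →
                            (∀ {a b} → a ∈ T → b >[ X ] a → b ∈ T) → IsBeginning X T
  upward-closed⇒beginning X T x∈ closed with least X (_∈? T) (_ , x∈)
  ... | w , w∈ , minimal = w , ⊆-antisym (from (∈L⁻⇔≯ X) ∘ minimal) above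
    where
    above : ∀ {z} → z ∈ L⁻ X w → z ∈ T
    above {z} z∈ with z ≟ w
    ... | yes refl = w∈
    ... | no z≢w with >-connex X z≢w
    ...   | inj₁ z>w = closed w∈ z>w
    ...   | inj₂ w>z = contradiction w>z (to (∈L⁻⇔≯ X) z∈)

  coincide⇒agreeAt-inside : (X Y : LinOrd n) {U : Subset n} → Separated X U → Separated Y U →
                            CoincideOn X Y U → ∀ {z} → z ∈ U → AgreeAt X Y z
  coincide⇒agreeAt-inside X Y {U} sX sY c {z} z∈ = mkAgreeAt λ j → by-side j (j ∈? U)
    where
    by-side : ∀ j → Dec (j ∈ U) → z >[ X ] j ⇔ z >[ Y ] j
    by-side j (yes j∈) = c z j z∈ j∈
    by-side j (no j∉)  = mk⇔ (λ _ → sY z∈ j∉) (λ _ → sX z∈ j∉)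

  coincide⇒agreeAt-outside : (X Y : LinOrd n) {U : Subset n} → Separated X U → Separated Y U →
                             CoincideOn X Y (∁ U) → ∀ {z} → z ∉ U → AgreeAt X Y z
  coincide⇒agreeAt-outside X Y {U} sX sY c {z} z∉ = mkAgreeAt λ j → by-side j (j ∈? U)
    where
    by-side : ∀ j → Dec (j ∈ U) → z >[ X ] j ⇔ z >[ Y ] j
    by-side j (yes j∈) =
      mk⇔ (contradiction (sX j∈ z∉) ∘ >-asym X) (contradiction (sY j∈ z∉) ∘ >-asym Y)
    by-side j (no j∉)  = c z j (x∉p⇒x∈∁p z∉) (x∉p⇒x∈∁p j∉)

  ¬coincide⇒disagreeAt : (X Y : LinOrd n) {S : Subset n} → ¬ CoincideOn X Y S →
                         ∃ λ z → z ∈ S × ¬ AgreeAt X Y z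
  ¬coincide⇒disagreeAt X Y {S} ¬c
    with ¬∀⟶∃¬ n _ (λ z → (z ∈? S) →-dec AgreeAt? X Y z)
                   (λ agree → ¬c λ i j i∈ _ → below⇔ (agree i i∈) j)
  ... | z , ¬[z∈S→agree] =
    z , decidable-stable (z ∈? S) (λ z∉ → ¬[z∈S→agree] λ z∈ → contradiction z∈ z∉) ,
    λ a → ¬[z∈S→agree] λ _ → a

-- Conditions (A) and (B)

module _ {n : ℕ} (L L' : LinOrd n) where

  condA⇒condB : CondA L L' → CondB L L'
  condA⇒condB (i , j , k , (i>k , _) , i≢j , L⁻k≢L'⁻k , L⁻i≡L'⁻j) =
    L⁻ L i , (i , ∈L⁻-refl L) , (k , k∉) , (beginL , beginL') , (¬coincide-inside , ¬coincide-outside)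
    where
    beginL : IsBeginning L (L⁻ L i)
    beginL = i , refl
    beginL' : IsBeginning L' (L⁻ L i)
    beginL' = j , L⁻i≡L'⁻j
    k∉ : k ∉ L⁻ L i
    k∉ k∈ = to (∈L⁻⇔≯ L) k∈ i>k
    sep = beginning⇒separated L beginL
    sep' = beginning⇒separated L' beginL'
    ¬coincide-inside : ¬ CoincideOn L L' (L⁻ L i)
    ¬coincide-inside c = i≢j (L⁻-injective L' (trans (sym L⁻i≡L'⁻i) L⁻i≡L'⁻j))
      where
      L⁻i≡L'⁻i = to (agreeAt⇔L⁻≡ L L') (coincide⇒agreeAt-inside L L' sep sep' c (∈L⁻-refl L))
    ¬coincide-outside : ¬ CoincideOn L L' (∁ (L⁻ L i))
    ¬coincide-outside c = L⁻k≢L'⁻k (to (agreeAt⇔L⁻≡ L L') (coincide⇒agreeAt-outside L L' sep sep' c k∉))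

  beginning-below-least-disagreement :
    {U : Subset n} → IsBeginning L U → IsBeginning L' U → ∀ {i} → i ∈ U →
    (∀ {z} → z ∈ U × ¬ AgreeAt L L' z → ¬ i >[ L ] z) → IsBeginning L' (L⁻ L i)
  beginning-below-least-disagreement {U} beginL beginL' {i} i∈U i-least =
    upward-closed⇒beginning L' (L⁻ L i) (∈L⁻-refl L) closed
    where
    sep' = beginning⇒separated L' beginL'
    L⁻i⊆U : ∀ {z} → z ∈ L⁻ L i → z ∈ U
    L⁻i⊆U z∈ = separated⇒upward-closed L (beginning⇒separated L beginL) i∈U (to (∈L⁻⇔≯ L) z∈)
    closed : ∀ {a b} → a ∈ L⁻ L i → b >[ L' ] a → b ∈ L⁻ L i
    closed {a} {b} a∈ b>'a = from (∈L⁻⇔≯ L) λ i>b → b-below-i i>b (b ∈? U)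
      where
      b-below-i : i >[ L ] b → Dec (b ∈ U) → ⊥
      b-below-i i>b (yes b∈U) =
        >-asym L' b>'a (agreeAt-above L L' agree-b (≯->-trans L (to (∈L⁻⇔≯ L) a∈) i>b))
        where
        agree-b = decidable-stable (AgreeAt? L L' b) λ ¬agree → i-least (b∈U , ¬agree) i>b
      b-below-i i>b (no b∉U) = >-asym L' b>'a (sep' (L⁻i⊆U a∈) b∉U)

  condB⇒condA : CondB L L' → CondA L L'
  condB⇒condA (U , _ , _ , (beginL , beginL') , (¬coincide-inside , ¬coincide-outside))
    with ¬coincide⇒disagreeAt L L' ¬coincide-outside
       | least L (λ z → (z ∈? U) ×-dec ¬? (AgreeAt? L L' z)) (¬coincide⇒disagreeAt L L' ¬coincide-inside)
  ... | k , k∈∁U , ¬agree-k | i , (i∈U , ¬agree-i) , i-least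
    with beginning-below-least-disagreement beginL beginL' i∈U i-least
  ... | j , L⁻i≡L'⁻j =
    i , j , k , (sep i∈U k∉ , sep j∈U k∉ , sep' i∈U k∉ , sep' j∈U k∉) , i≢j ,
    ¬agree-k ∘ from (agreeAt⇔L⁻≡ L L') , L⁻i≡L'⁻j
    where
    sep = beginning⇒separated L beginL
    sep' = beginning⇒separated L' beginL'
    k∉ = x∈∁p⇒x∉p k∈∁U
    j∈U : j ∈ U
    j∈U = separated⇒upward-closed L sep i∈U
            (to (∈L⁻⇔≯ L) (subst (j ∈_) (sym L⁻i≡L'⁻j) (∈L⁻-refl L')))
    i≢j : i ≢ j
    i≢j refl = ¬agree-i (from (agreeAt⇔L⁻≡ L L') L⁻i≡L'⁻j)

condB-sym : {n : ℕ} {L L' : LinOrd n} → CondB L L' → CondB L' L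
condB-sym {L = L} {L'} (U , nonempty , proper , (beginL , beginL') , (¬coincide-inside , ¬coincide-outside)) =
  U , nonempty , proper , (beginL' , beginL) , (¬coincide-inside ∘ swap , ¬coincide-outside ∘ swap)
  where
  swap : ∀ {S} → CoincideOn L' L S → CoincideOn L L' S
  swap c i j i∈ j∈ = ⇔.sym (c i j i∈ j∈)

module _ {n : ℕ} (L L' M : LinOrd n) (agrees : ∀ i → AgreeAt L M i ⊎ AgreeAt L' M i) where

  agreeAt-other : ∀ {i} → ¬ AgreeAt L M i → AgreeAt L' M i
  agreeAt-other ¬agree = [ (λ agree → contradiction agree ¬agree) , id ]′ (agrees _)

  -- U is the set of elements above v, the M-greatest element below x at which M disagrees with L.
  splitting-beginning-set : ∀ {x y} → AgreeAt L M x → ¬ AgreeAt L' M x → ¬ AgreeAt L M y →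
                            x >[ M ] y → CondB L L'
  splitting-beginning-set {x} {y} agree-x ¬agree'-x ¬agree-y x>y
    with greatest M (λ z → (x >[ M ]? z) ×-dec ¬? (AgreeAt? L M z)) (y , x>y , ¬agree-y)
  ... | v , (x>v , ¬agree-v) , v-greatest =
    U , (x , x∈U) , (y , y∉U) , (beginL , beginL') , (¬coincide-inside , ¬coincide-outside)
    where
    U : Subset n
    U = tabulate (λ z → ⌊ z >[ M ]? v ⌋)
    ∈U : ∀ {z} → z ∈ U ⇔ z >[ M ] v
    ∈U = ∈-tabulate (_>[ M ]? v)
    x∈U = from ∈U x>v
    y∉U : y ∉ U
    y∉U y∈ = v-greatest (x>y , ¬agree-y) (to ∈U y∈)
    agree'-v = agreeAt-other ¬agree-v
    agree-at-least : ∀ {u} → U ≡ L⁻ M u → AgreeAt L M u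
    agree-at-least {u} U≡ with u ≟ x
    ... | yes refl = agree-x
    ... | no u≢x with >-connex M (u≢x ∘ sym)
    ...   | inj₂ u>x = contradiction u>x (to (∈L⁻⇔≯ M) (subst (x ∈_) U≡ x∈U))
    ...   | inj₁ x>u = decidable-stable (AgreeAt? L M u) λ ¬agree-u →
      v-greatest (x>u , ¬agree-u) (to ∈U (subst (u ∈_) (sym U≡) (∈L⁻-refl M)))
    beginL : IsBeginning L U
    beginL with upward-closed⇒beginning M U x∈U (λ a∈ b>a → from ∈U (>-trans M b>a (to ∈U a∈)))
    ... | u , U≡ = u , trans U≡ (to (agreeAt⇔L⁻≡ M L) (agreeAt-sym (agree-at-least U≡)))
    beginL' : IsBeginning L' U
    beginL' = upward-closed⇒beginning L' U x∈U λ a∈ b>'a → from ∈U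
      (agreeAt-above L' M agree'-v (>-trans L' b>'a (agreeAt-above M L' (agreeAt-sym agree'-v) (to ∈U a∈))))
    sepL = beginning⇒separated L beginL
    sepL' = beginning⇒separated L' beginL'
    ¬coincide-inside : ¬ CoincideOn L L' U
    ¬coincide-inside c =
      ¬agree'-x (agreeAt-trans (agreeAt-sym (coincide⇒agreeAt-inside L L' sepL sepL' c x∈U)) agree-x)
    ¬coincide-outside : ¬ CoincideOn L L' (∁ U)
    ¬coincide-outside c =
      ¬agree-y (agreeAt-trans (coincide⇒agreeAt-outside L L' sepL sepL' c y∉U) (agreeAt-other ¬agree-y))

agreeAt-everywhere : {n : ℕ} (L L' M : LinOrd n) → ¬ CondB L L' →
                     (∀ i → AgreeAt L M i ⊎ AgreeAt L' M i) → (∀ i → AgreeAt L M i) ⊎ (∀ i → AgreeAt L' M i)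
agreeAt-everywhere {n} L L' M ¬condB agrees with all? (AgreeAt? L M) | all? (AgreeAt? L' M)
... | yes agree | _          = inj₁ agree
... | no _      | yes agree' = inj₂ agree'
... | no ¬agree | no ¬agree'
  with ¬∀⟶∃¬ n _ (AgreeAt? L M) ¬agree | ¬∀⟶∃¬ n _ (AgreeAt? L' M) ¬agree'
... | y , ¬agree-y | x , ¬agree'-x = ⊥-elim (split (>-connex M x≢y))
  where
  agree-x = agreeAt-other L' L M (Sum.swap ∘ agrees) ¬agree'-x
  agree'-y = agreeAt-other L L' M agrees ¬agree-y
  x≢y : x ≢ y
  x≢y refl = ¬agree-y agree-x
  split : x >[ M ] y ⊎ y >[ M ] x → ⊥
  split (inj₁ x>y) = ¬condB (splitting-beginning-set L L' M agrees agree-x ¬agree'-x ¬agree-y x>y)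
  split (inj₂ y>x) = ¬condB (condB-sym {L = L'} {L}
    (splitting-beginning-set L' L M (Sum.swap ∘ agrees) agree'-y ¬agree-y ¬agree'-x y>x))

-- Gluing two orders along a common beginning set

module _ {n : ℕ} (key : Fin n → ℕ) (key-injective : Injective _≡_ _≡_ key) where

  keyBelow : Fin n → Subset n
  keyBelow x = tabulate (λ z → ⌊ key z ℕ.<? key x ⌋)

  ∈keyBelow : ∀ {x z} → z ∈ keyBelow x ⇔ key z ℕ.< key x
  ∈keyBelow {x} = ∈-tabulate (λ z → key z ℕ.<? key x)

  keyBelow-⊂ : ∀ {x z} → key z ℕ.< key x → keyBelow z ⊂ keyBelow x
  keyBelow-⊂ {x} {z} z<x =
    (λ y∈ → from ∈keyBelow (ℕ.<-trans (to ∈keyBelow y∈) z<x)) ,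
    z , from ∈keyBelow z<x , λ z∈ → ℕ.<-irrefl refl (to ∈keyBelow z∈)

  ∣keyBelow∣<n : ∀ x → ∣ keyBelow x ∣ ℕ.< n
  ∣keyBelow∣<n x = subst (∣ keyBelow x ∣ ℕ.<_) (∣⊤∣≡n n)
    (p⊂q⇒∣p∣<∣q∣ ((λ _ → ∈⊤) , x , ∈⊤ , λ x∈ → ℕ.<-irrefl refl (to ∈keyBelow x∈)))

  keyRank : Fin n → Fin n
  keyRank x = fromℕ< (∣keyBelow∣<n x)

  toℕ-keyRank : ∀ x → toℕ (keyRank x) ≡ ∣ keyBelow x ∣
  toℕ-keyRank x = Fin.toℕ-fromℕ< (∣keyBelow∣<n x)

  keyRank-mono-< : ∀ {a b} → key a ℕ.< key b → toℕ (keyRank a) ℕ.< toℕ (keyRank b)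
  keyRank-mono-< {a} {b} a<b =
    subst₂ ℕ._<_ (sym (toℕ-keyRank a)) (sym (toℕ-keyRank b)) (p⊂q⇒∣p∣<∣q∣ (keyBelow-⊂ a<b))

  keyRank-mono-≤ : ∀ {a b} → key a ℕ.≤ key b → toℕ (keyRank a) ℕ.≤ toℕ (keyRank b)
  keyRank-mono-≤ {a} {b} a≤b = subst₂ ℕ._≤_ (sym (toℕ-keyRank a)) (sym (toℕ-keyRank b))
    (p⊆q⇒∣p∣≤∣q∣ λ y∈ → from ∈keyBelow (ℕ.<-≤-trans (to ∈keyBelow y∈) a≤b))

  keyRank-injective : Injective _≡_ _≡_ keyRank
  keyRank-injective {x} {y} eq with ℕ.<-cmp (key x) (key y)
  ... | tri< x<y _ _ = contradiction (keyRank-mono-< x<y) (ℕ.<-irrefl (cong toℕ eq))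
  ... | tri≈ _ x≡y _ = key-injective x≡y
  ... | tri> _ _ y<x = contradiction (keyRank-mono-< y<x) (ℕ.<-irrefl (cong toℕ (sym eq)))

  keyOrder : LinOrd n
  keyOrder = record { rank = keyRank ; rank-inj = keyRank-injective }

  keyOrder-> : ∀ {x z} → x >[ keyOrder ] z ⇔ key z ℕ.< key x
  keyOrder-> {x} {z} = mk⇔
    (λ x>z → decidable-stable (key z ℕ.<? key x) λ z≮x → ℕ.<⇒≱ x>z (keyRank-mono-≤ (ℕ.≮⇒≥ z≮x)))
    keyRank-mono-<

module _ {n : ℕ} (A B : LinOrd n) (U : Subset n) where

  glueKey : Fin n → ℕ
  glueKey x with x ∈? U
  ... | yes _ = n ℕ.+ toℕ (rank A x)
  ... | no _  = toℕ (rank B x)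

  glueKey-injective : Injective _≡_ _≡_ glueKey
  glueKey-injective {x} {y} eq with x ∈? U | y ∈? U
  ... | yes _ | yes _ = rank-inj A (Fin.toℕ-injective (ℕ.+-cancelˡ-≡ n _ _ eq))
  ... | yes _ | no _  = contradiction (subst (n ℕ.≤_) eq (ℕ.m≤m+n n _)) (ℕ.<⇒≱ (Fin.toℕ<n (rank B y)))
  ... | no _  | yes _ =
    contradiction (subst (n ℕ.≤_) (sym eq) (ℕ.m≤m+n n _)) (ℕ.<⇒≱ (Fin.toℕ<n (rank B x)))
  ... | no _  | no _  = rank-inj B (Fin.toℕ-injective eq)

  glue : LinOrd n
  glue = keyOrder glueKey glueKey-injective

  glue-> : ∀ {x j} → x >[ glue ] j ⇔ glueKey j ℕ.< glueKey x
  glue-> {x} {j} = keyOrder-> glueKey glueKey-injective {x} {j}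

  glue-agreeAt-inside : Separated A U → ∀ {x} → x ∈ U → AgreeAt A glue x
  glue-agreeAt-inside sepA {x} x∈ = mkAgreeAt λ j → ⇔.trans (by-keys j) (⇔.sym (glue-> {x} {j}))
    where
    by-keys : ∀ j → x >[ A ] j ⇔ glueKey j ℕ.< glueKey x
    by-keys j with x ∈? U | j ∈? U
    ... | no x∉  | _      = contradiction x∈ x∉
    ... | yes _  | yes _  = mk⇔ (ℕ.+-monoʳ-< n) (ℕ.+-cancelˡ-< n _ _)
    ... | yes _  | no j∉  =
      mk⇔ (λ _ → ℕ.<-≤-trans (Fin.toℕ<n (rank B j)) (ℕ.m≤m+n n _)) (λ _ → sepA x∈ j∉)

  glue-agreeAt-outside : Separated B U → ∀ {x} → x ∉ U → AgreeAt B glue x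
  glue-agreeAt-outside sepB {x} x∉ = mkAgreeAt λ j → ⇔.trans (by-keys j) (⇔.sym (glue-> {x} {j}))
    where
    by-keys : ∀ j → x >[ B ] j ⇔ glueKey j ℕ.< glueKey x
    by-keys j with x ∈? U | j ∈? U
    ... | yes x∈ | _      = contradiction x∈ x∉
    ... | no _   | no _   = ⇔.refl
    ... | no _   | yes j∈ = mk⇔ (λ x>j → contradiction x>j (>-asym B (sepB j∈ x∉)))
      (λ j<x → contradiction j<x (ℕ.<-asym (ℕ.<-≤-trans (Fin.toℕ<n (rank B x)) (ℕ.m≤m+n n _))))

𝟙 : Bool → ℚ
𝟙 b = if b then 1ℚ else 0ℚ

0<1 : 0ℚ < 1ℚ
0<1 = ℚ.positive⁻¹ 1ℚ

0≤𝟙 : ∀ b → 0ℚ ≤ 𝟙 b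
0≤𝟙 true  = ℚ.<⇒≤ 0<1
0≤𝟙 false = ℚ.≤-refl

𝟙-∧ : ∀ a b → 𝟙 (a ∧ b) ≡ 𝟙 a * 𝟙 b
𝟙-∧ true  true  = refl
𝟙-∧ true  false = refl
𝟙-∧ false true  = refl
𝟙-∧ false false = refl

𝟙-true : {A : Set} (a? : Dec A) → A → 𝟙 ⌊ a? ⌋ ≡ 1ℚ
𝟙-true a? a = cong 𝟙 (trans (Dec.isYes≗does a?) (Dec.dec-true a? a))

𝟙⌊⌋-≡⇒ : {A B : Set} (a? : Dec A) (b? : Dec B) → 𝟙 ⌊ a? ⌋ ≡ 𝟙 ⌊ b? ⌋ → A → B
𝟙⌊⌋-≡⇒ (yes _) (yes b) _  _ = b
𝟙⌊⌋-≡⇒ (yes _) (no _)  () _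
𝟙⌊⌋-≡⇒ (no ¬a) _       _  a = contradiction a ¬a

𝟙-+-≤ : {A B C : Set} (a? : Dec A) (b? : Dec B) (c? : Dec C) → (A → B → C) →
        𝟙 ⌊ a? ⌋ + 𝟙 ⌊ b? ⌋ ≤ 1ℚ + 𝟙 ⌊ c? ⌋
𝟙-+-≤ a? b? c? a→b→c with a? | b? | c?
... | yes a | yes b | yes _ = ℚ.≤-refl
... | yes a | yes b | no ¬c = contradiction (a→b→c a b) ¬c
... | yes _ | no _  | c?′   = ℚ.+-monoʳ-≤ 1ℚ (0≤𝟙 ⌊ c?′ ⌋)
... | no _  | yes _ | c?′   = ℚ.+-monoʳ-≤ 1ℚ (0≤𝟙 ⌊ c?′ ⌋)
... | no _  | no _  | c?′   = ℚ.+-mono-≤ (ℚ.<⇒≤ 0<1) (0≤𝟙 ⌊ c?′ ⌋)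

𝟙-+-≡ : {A B C : Set} (a? : Dec A) (b? : Dec B) (c? : Dec C) →
        𝟙 ⌊ a? ⌋ + 𝟙 ⌊ b? ⌋ ≡ 1ℚ + 𝟙 ⌊ c? ⌋ → A ⊎ B
𝟙-+-≡ a? b? c? eq with a? | b?
... | yes a | _     = inj₁ a
... | no _  | yes b = inj₂ b
... | no _  | no _  = contradiction eq (ℚ.<⇒≢ (ℚ.+-mono-<-≤ 0<1 (0≤𝟙 ⌊ c? ⌋)))

+-≤-≡⇒≡ : {x y s t : ℚ} → x ≤ y → s ≤ t → x + s ≡ y + t → x ≡ y × s ≡ t
+-≤-≡⇒≡ x≤y s≤t eq =
  ℚ.≤-antisym x≤y (ℚ.≮⇒≥ λ y>x → ℚ.<⇒≢ (ℚ.+-mono-<-≤ y>x s≤t) eq) ,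
  ℚ.≤-antisym s≤t (ℚ.≮⇒≥ λ t>s → ℚ.<⇒≢ (ℚ.+-mono-≤-< x≤y t>s) eq)

nonNeg-*-≡ : {w a b : ℚ} → 0ℚ ≤ w → a ≤ b → w * a ≡ w * b → w ≡ 0ℚ ⊎ a ≡ b
nonNeg-*-≡ {w} 0≤w a≤b eq with ℚ.<-cmp 0ℚ w
... | tri≈ _ 0≡w _ = inj₁ (sym 0≡w)
... | tri> _ _ w<0 = contradiction (ℚ.<-≤-trans w<0 0≤w) (ℚ.<-irrefl refl)
... | tri< 0<w _ _ =
  inj₂ (ℚ.≤-antisym a≤b (ℚ.≮⇒≥ λ a<b → ℚ.<⇒≢ (ℚ.*-monoʳ-<-pos w {{positive 0<w}} a<b) eq))

∑ : {A : Set} → (A → ℚ) → List A → ℚ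
∑ f xs = sumℚ (map f xs)

sumℚ-++ : (xs ys : List ℚ) → sumℚ (xs ++ ys) ≡ sumℚ xs + sumℚ ys
sumℚ-++ []       ys = sym (ℚ.+-identityˡ _)
sumℚ-++ (x ∷ xs) ys = trans (cong (x +_) (sumℚ-++ xs ys)) (sym (ℚ.+-assoc x _ _))

sumℚ-concatMap : {A : Set} (g : A → List ℚ) (xs : List A) → sumℚ (concatMap g xs) ≡ ∑ (sumℚ ∘ g) xs
sumℚ-concatMap g []       = refl
sumℚ-concatMap g (x ∷ xs) =
  trans (sumℚ-++ (g x) (concatMap g xs)) (cong (sumℚ (g x) +_) (sumℚ-concatMap g xs))

∑-++ : {A : Set} (f : A → ℚ) (xs ys : List A) → ∑ f (xs ++ ys) ≡ ∑ f xs + ∑ f ys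
∑-++ f xs ys = trans (cong sumℚ (List.map-++ f xs ys)) (sumℚ-++ (map f xs) (map f ys))

module _ {A : Set} where

  ∑-cong : {f g : A → ℚ} (xs : List A) → (∀ a → f a ≡ g a) → ∑ f xs ≡ ∑ g xs
  ∑-cong []       f≗g = refl
  ∑-cong (x ∷ xs) f≗g = cong₂ _+_ (f≗g x) (∑-cong xs f≗g)

  ∑-distrib-+ : (f g : A → ℚ) (xs : List A) → ∑ (λ a → f a + g a) xs ≡ ∑ f xs + ∑ g xs
  ∑-distrib-+ f g []       = sym (ℚ.+-identityˡ 0ℚ)
  ∑-distrib-+ f g (x ∷ xs) = trans (cong ((f x + g x) +_) (∑-distrib-+ f g xs))
    (solve 4 (λ a b c d → (a :+ b) :+ (c :+ d) := (a :+ c) :+ (b :+ d)) refl (f x) (g x) (∑ f xs) (∑ g xs))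

  ∑-distribˡ-* : (t : ℚ) (f : A → ℚ) (xs : List A) → ∑ (λ a → t * f a) xs ≡ t * ∑ f xs
  ∑-distribˡ-* t f []       = sym (ℚ.*-zeroʳ t)
  ∑-distribˡ-* t f (x ∷ xs) =
    trans (cong (t * f x +_) (∑-distribˡ-* t f xs)) (sym (ℚ.*-distribˡ-+ t (f x) _))

  ∑-zero : (xs : List A) → ∑ (λ _ → 0ℚ) xs ≡ 0ℚ
  ∑-zero []       = refl
  ∑-zero (x ∷ xs) = trans (cong (0ℚ +_) (∑-zero xs)) (ℚ.+-identityˡ 0ℚ)

  ∑-map : {B : Set} (f : B → ℚ) (g : A → B) (xs : List A) → ∑ f (map g xs) ≡ ∑ (f ∘ g) xs
  ∑-map f g xs = cong sumℚ (sym (List.map-∘ xs))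

  ∑-mono-≤ : {f g : A → ℚ} {xs : List A} → All (λ a → f a ≤ g a) xs → ∑ f xs ≤ ∑ g xs
  ∑-mono-≤ []           = ℚ.≤-refl
  ∑-mono-≤ (fx≤gx ∷ f≤g) = ℚ.+-mono-≤ fx≤gx (∑-mono-≤ f≤g)

  ∑-≤-≡⇒≡ : {f g : A → ℚ} {xs : List A} →
            All (λ a → f a ≤ g a) xs → ∑ f xs ≡ ∑ g xs → All (λ a → f a ≡ g a) xs
  ∑-≤-≡⇒≡ []            _  = []
  ∑-≤-≡⇒≡ (fx≤gx ∷ f≤g) eq with +-≤-≡⇒≡ fx≤gx (∑-mono-≤ f≤g) eq
  ... | fx≡gx , rest = fx≡gx ∷ ∑-≤-≡⇒≡ f≤g rest

∏-zero : ∀ {n} (f : Fin n → ℚ) (i : Fin n) → f i ≡ 0ℚ → ∏ f ≡ 0ℚ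
∏-zero f Fin.zero    fi≡0 = trans (cong (_* ∏ (f ∘ Fin.suc)) fi≡0) (ℚ.*-zeroˡ (∏ (f ∘ Fin.suc)))
∏-zero f (Fin.suc i) fi≡0 =
  trans (cong (f Fin.zero *_) (∏-zero (f ∘ Fin.suc) i fi≡0)) (ℚ.*-zeroʳ (f Fin.zero))

∏-𝟙-all : ∀ {n} {P : Fin n → Set} (P? : Decidable P) (every? : Dec (∀ j → P j)) →
          ∏ (λ j → 𝟙 ⌊ P? j ⌋) ≡ 𝟙 ⌊ every? ⌋
∏-𝟙-all {zero}  P? (yes _)   = refl
∏-𝟙-all {zero}  P? (no ¬all) = contradiction (λ ()) ¬all
∏-𝟙-all {suc n} P? every? with P? Fin.zero | every?
... | yes p₀ | yes all = trans (ℚ.*-identityˡ _) (∏-𝟙-all (P? ∘ Fin.suc) (yes (all ∘ Fin.suc)))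
... | yes p₀ | no ¬all = trans (ℚ.*-identityˡ _)
  (∏-𝟙-all (P? ∘ Fin.suc) (no λ rest → ¬all λ { Fin.zero → p₀ ; (Fin.suc j) → rest j }))
... | no ¬p₀ | yes all = contradiction (all Fin.zero) ¬p₀
... | no ¬p₀ | no _    = ℚ.*-zeroˡ (∏ (λ j → 𝟙 ⌊ P? (Fin.suc j) ⌋))

𝟙-allᵇ-tabulate : {A : Set} (n : ℕ) (g : Fin n → A) (f : A → Bool) →
                   𝟙 (allᵇ f (List.tabulate g)) ≡ ∏ (λ j → 𝟙 (f (g j)))
𝟙-allᵇ-tabulate zero    g f = refl
𝟙-allᵇ-tabulate (suc n) g f =
  trans (𝟙-∧ (f (g Fin.zero)) _) (cong (𝟙 (f (g Fin.zero)) *_) (𝟙-allᵇ-tabulate n (g ∘ Fin.suc) f))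

∑-allSubsets-∏ : (n : ℕ) (φ : Fin n → Bool → ℚ) →
                 ∑ (λ S → ∏ (λ j → φ j (lookup S j))) (allSubsets n) ≡ ∏ (λ j → φ j true + φ j false)
∑-allSubsets-∏ zero    φ = refl
∑-allSubsets-∏ (suc n) φ = begin
  ∑ G (map (true ∷_) A ++ map (false ∷_) A)
    ≡⟨ ∑-++ G (map (true ∷_) A) (map (false ∷_) A) ⟩
  ∑ G (map (true ∷_) A) + ∑ G (map (false ∷_) A)
    ≡⟨ cong₂ _+_ (∑-map G (true ∷_) A) (∑-map G (false ∷_) A) ⟩
  ∑ (λ S → φ₀ true * H S) A + ∑ (λ S → φ₀ false * H S) A
    ≡⟨ cong₂ _+_ (∑-distribˡ-* (φ₀ true) H A) (∑-distribˡ-* (φ₀ false) H A) ⟩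
  φ₀ true * ∑ H A + φ₀ false * ∑ H A
    ≡⟨ sym (ℚ.*-distribʳ-+ (∑ H A) (φ₀ true) (φ₀ false)) ⟩
  (φ₀ true + φ₀ false) * ∑ H A
    ≡⟨ cong ((φ₀ true + φ₀ false) *_) (∑-allSubsets-∏ n (φ ∘ Fin.suc)) ⟩
  ∏ (λ j → φ j true + φ j false) ∎
  where
  open ≡-Reasoning
  A = allSubsets n
  φ₀ = φ Fin.zero
  G : Subset (suc n) → ℚ
  G S = ∏ (λ j → φ j (lookup S j))
  H : Subset n → ℚ
  H S = ∏ (λ j → φ (Fin.suc j) (lookup S j))

module _ {n : ℕ} where

  entry : QVec n → QVec n → Fin n → Subset n → ℚ
  entry c x i S = if lookup S i then c i S * x i S else 0ℚ

  ∑E : (Fin n → Subset n → ℚ) → ℚ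
  ∑E h = ∑ (λ i → ∑ (h i) (allSubsets n)) (allFin n)

  ∑E-cong : {h g : Fin n → Subset n → ℚ} → (∀ i S → h i S ≡ g i S) → ∑E h ≡ ∑E g
  ∑E-cong h≗g = ∑-cong (allFin n) (λ i → ∑-cong (allSubsets n) (h≗g i))

  ∑E-distrib-+ : (h g : Fin n → Subset n → ℚ) → ∑E (λ i S → h i S + g i S) ≡ ∑E h + ∑E g
  ∑E-distrib-+ h g = trans (∑-cong (allFin n) (λ i → ∑-distrib-+ (h i) (g i) (allSubsets n)))
                           (∑-distrib-+ _ _ (allFin n))

  ∑E-distribˡ-* : (t : ℚ) (h : Fin n → Subset n → ℚ) → ∑E (λ i S → t * h i S) ≡ t * ∑E h
  ∑E-distribˡ-* t h = trans (∑-cong (allFin n) (λ i → ∑-distribˡ-* t (h i) (allSubsets n)))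
                            (∑-distribˡ-* t _ (allFin n))

  ∑E-zero : ∑E (λ _ _ → 0ℚ) ≡ 0ℚ
  ∑E-zero = trans (∑-cong (allFin n) (λ _ → ∑-zero (allSubsets n))) (∑-zero (allFin n))

  dot≡∑E : (c x : QVec n) → dot c x ≡ ∑E (entry c x)
  dot≡∑E c x = sumℚ-concatMap _ (allFin n)

  dot-via-entries : (c x : QVec n) {h : Fin n → Subset n → ℚ} →
                    (∀ i S → entry c x i S ≡ h i S) → dot c x ≡ ∑E h
  dot-via-entries c x e = trans (dot≡∑E c x) (∑E-cong e)

  entry-cong : (c : QVec n) {x y : QVec n} (i : Fin n) → (∀ S → i ∈ S → x i S ≡ y i S) →
               ∀ S → entry c x i S ≡ entry c y i S
  entry-cong c i x≈y S with lookup S i in S[i]≡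
  ... | true  = cong (c i S *_) (x≈y S (lookup⇒[]= i S S[i]≡))
  ... | false = refl

  dot-cong : (c : QVec n) {x y : QVec n} → x ≈E y → dot c x ≡ dot c y
  dot-cong c {x} {y} x≈y =
    trans (dot-via-entries c x λ i → entry-cong c {x} {y} i (x≈y i)) (sym (dot≡∑E c y))

  dot-⊕ˡ : (c d x : QVec n) → dot (c ⊕ d) x ≡ dot c x + dot d x
  dot-⊕ˡ c d x = trans (dot-via-entries (c ⊕ d) x entry≡)
    (trans (∑E-distrib-+ _ _) (sym (cong₂ _+_ (dot≡∑E c x) (dot≡∑E d x))))
    where
    entry≡ : ∀ i S → entry (c ⊕ d) x i S ≡ entry c x i S + entry d x i S
    entry≡ i S with lookup S i
    ... | true  = ℚ.*-distribʳ-+ (x i S) (c i S) (d i S)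
    ... | false = sym (ℚ.+-identityˡ 0ℚ)

  dot-⊕ʳ : (c x y : QVec n) → dot c (x ⊕ y) ≡ dot c x + dot c y
  dot-⊕ʳ c x y = trans (dot-via-entries c (x ⊕ y) entry≡)
    (trans (∑E-distrib-+ _ _) (sym (cong₂ _+_ (dot≡∑E c x) (dot≡∑E c y))))
    where
    entry≡ : ∀ i S → entry c (x ⊕ y) i S ≡ entry c x i S + entry c y i S
    entry≡ i S with lookup S i
    ... | true  = ℚ.*-distribˡ-+ (c i S) (x i S) (y i S)
    ... | false = sym (ℚ.+-identityˡ 0ℚ)

  dot-scale : (c : QVec n) (t : ℚ) (x : QVec n) → dot c (scale t x) ≡ t * dot c x
  dot-scale c t x = trans (dot-via-entries c (scale t x) entry≡)
    (trans (∑E-distribˡ-* t _) (cong (t *_) (sym (dot≡∑E c x))))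
    where
    entry≡ : ∀ i S → entry c (scale t x) i S ≡ t * entry c x i S
    entry≡ i S with lookup S i
    ... | true  = solve 3 (λ a b d → a :* (b :* d) := b :* (a :* d)) refl (c i S) t (x i S)
    ... | false = sym (ℚ.*-zeroʳ t)

  dot-zero : (c : QVec n) → dot c zeroV ≡ 0ℚ
  dot-zero c = trans (dot-via-entries c zeroV entry≡) ∑E-zero
    where
    entry≡ : ∀ i S → entry c zeroV i S ≡ 0ℚ
    entry≡ i S with lookup S i
    ... | true  = ℚ.*-zeroʳ (c i S)
    ... | false = refl

  combination : List (ℚ × LinOrd n) → QVec n
  combination = foldr (λ w acc → scale (proj₁ w) (p (proj₂ w)) ⊕ acc) zeroV

  dot-combination : (c : QVec n) (ws : List (ℚ × LinOrd n)) →
                    dot c (combination ws) ≡ ∑ (λ w → proj₁ w * dot c (p (proj₂ w))) ws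
  dot-combination c []       = dot-zero c
  dot-combination c (w ∷ ws) =
    trans (dot-⊕ʳ c _ _) (cong₂ _+_ (dot-scale c (proj₁ w) _) (dot-combination c ws))

-- The Möbius vectors μ_X and the functional ⟨μ_L + μ_L', ·⟩

möbiusFactor : Bool → Bool → ℚ
möbiusFactor false b     = 𝟙 b
möbiusFactor true  true  = - 1ℚ
möbiusFactor true  false = 1ℚ

module _ {n : ℕ} where

  möbius : LinOrd n → QVec n
  möbius X i S = ∏ (λ j → möbiusFactor ⌊ j >[ X ]? i ⌋ (lookup S j))

  entry-möbius : (X : LinOrd n) (x : QVec n) (i : Fin n) (S : Subset n) →
                 entry (möbius X) x i S ≡ möbius X i S * x i S
  entry-möbius X x i S with lookup S i in S[i]≡
  ... | true  = refl
  ... | false = sym (trans (cong (_* x i S) (∏-zero _ i factor-i≡0)) (ℚ.*-zeroˡ (x i S)))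
    where
    factor-i≡0 : möbiusFactor ⌊ i >[ X ]? i ⌋ (lookup S i) ≡ 0ℚ
    factor-i≡0 with i >[ X ]? i
    ... | yes i>i = contradiction i>i (>-irrefl X)
    ... | no _    rewrite S[i]≡ = refl

  dominates : LinOrd n → Fin n → Subset n → Fin n → Bool
  dominates M i S j = not (lookup S j) ∨ ⌊ j ≟ i ⌋ ∨ ⌊ i >[ M ]? j ⌋

  p≡∏ : (M : LinOrd n) (i : Fin n) (S : Subset n) → p M i S ≡ ∏ (𝟙 ∘ dominates M i S)
  p≡∏ M i S = 𝟙-allᵇ-tabulate n id (dominates M i S)

  p-agreeAt : (X M : LinOrd n) {i : Fin n} → AgreeAt X M i → ∀ S → p M i S ≡ p X i S
  p-agreeAt X M {i} agree S = trans (p≡∏ M i S) (trans (∏-cong dominates≡) (sym (p≡∏ X i S)))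
    where
    dominates≡ : ∀ j → 𝟙 (dominates M i S j) ≡ 𝟙 (dominates X i S j)
    dominates≡ j = cong (λ b → 𝟙 (not (lookup S j) ∨ ⌊ j ≟ i ⌋ ∨ b))
                        (⌊⌋-⇔ (⇔.sym (below⇔ agree j)) (i >[ M ]? j) (i >[ X ]? j))

  möbiusTerm : LinOrd n → LinOrd n → Fin n → Fin n → Bool → ℚ
  möbiusTerm X M i j b = möbiusFactor ⌊ j >[ X ]? i ⌋ b * 𝟙 (not b ∨ ⌊ j ≟ i ⌋ ∨ ⌊ i >[ M ]? j ⌋)

  möbiusTerm-sum : (X M : LinOrd n) (i j : Fin n) →
                   möbiusTerm X M i j true + möbiusTerm X M i j false
                     ≡ 𝟙 ⌊ (i >[ X ]? j) ⇔? (i >[ M ]? j) ⌋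
  möbiusTerm-sum X M i j with j ≟ i | j >[ X ]? i | i >[ X ]? j | i >[ M ]? j
  ... | yes refl | yes i>i | _       | _       = contradiction i>i (>-irrefl X)
  ... | yes refl | no _    | yes i>i | _       = contradiction i>i (>-irrefl X)
  ... | yes refl | no _    | no _    | yes i>i = contradiction i>i (>-irrefl M)
  ... | yes refl | no _    | no _    | no _    = refl
  ... | no _     | yes j>i | yes i>j | _       = contradiction i>j (>-asym X j>i)
  ... | no _     | yes _   | no _    | yes _   = refl
  ... | no _     | yes _   | no _    | no _    = refl
  ... | no _     | no _    | yes _   | yes _   = refl
  ... | no _     | no _    | yes _   | no _    = refl
  ... | no j≢i   | no j≯i  | no i≯j  | _       = contradiction (≯-antisym X j≯i i≯j) j≢i

  ∑-möbius-p : (X M : LinOrd n) (i : Fin n) →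
               ∑ (entry (möbius X) (p M) i) (allSubsets n) ≡ 𝟙 ⌊ AgreeAt? X M i ⌋
  ∑-möbius-p X M i = begin
    ∑ (entry (möbius X) (p M) i) (allSubsets n)
      ≡⟨ ∑-cong (allSubsets n) (λ S → trans (entry-möbius X (p M) i S)
                                             (cong (möbius X i S *_) (p≡∏ M i S))) ⟩
    ∑ (λ S → möbius X i S * ∏ (𝟙 ∘ dominates M i S)) (allSubsets n)
      ≡⟨ ∑-cong (allSubsets n) (λ S → sym (∏-distrib-* (μ S) (𝟙 ∘ dominates M i S))) ⟩
    ∑ (λ S → ∏ (λ j → möbiusTerm X M i j (lookup S j))) (allSubsets n)
      ≡⟨ ∑-allSubsets-∏ n (möbiusTerm X M i) ⟩
    ∏ (λ j → möbiusTerm X M i j true + möbiusTerm X M i j false)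
      ≡⟨ ∏-cong (möbiusTerm-sum X M i) ⟩
    ∏ (λ j → 𝟙 ⌊ (i >[ X ]? j) ⇔? (i >[ M ]? j) ⌋)
      ≡⟨ ∏-𝟙-all _ (all? λ j → (i >[ X ]? j) ⇔? (i >[ M ]? j)) ⟩
    𝟙 ⌊ all? (λ j → (i >[ X ]? j) ⇔? (i >[ M ]? j)) ⌋
      ≡⟨ cong 𝟙 (⌊⌋-⇔ (mk⇔ mkAgreeAt below⇔) _ (AgreeAt? X M i)) ⟩
    𝟙 ⌊ AgreeAt? X M i ⌋ ∎
    where
    open ≡-Reasoning
    μ : Subset n → Fin n → ℚ
    μ S j = möbiusFactor ⌊ j >[ X ]? i ⌋ (lookup S j)

  dot-möbius-p : (X M : LinOrd n) → dot (möbius X) (p M) ≡ ∑ (λ i → 𝟙 ⌊ AgreeAt? X M i ⌋) (allFin n)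
  dot-möbius-p X M = trans (dot≡∑E (möbius X) (p M)) (∑-cong (allFin n) (∑-möbius-p X M))

  p-row-determines-agreeAt : (X Y : LinOrd n) (z : Fin n) → (∀ S → z ∈ S → p X z S ≡ p Y z S) →
                             AgreeAt X Y z
  p-row-determines-agreeAt X Y z rows≡ = 𝟙⌊⌋-≡⇒ (AgreeAt? X X z) (AgreeAt? X Y z) (begin
    𝟙 ⌊ AgreeAt? X X z ⌋
      ≡⟨ sym (∑-möbius-p X X z) ⟩
    ∑ (entry (möbius X) (p X) z) (allSubsets n)
      ≡⟨ ∑-cong (allSubsets n) (entry-cong (möbius X) {p X} {p Y} z rows≡) ⟩
    ∑ (entry (möbius X) (p Y) z) (allSubsets n)
      ≡⟨ ∑-möbius-p X Y z ⟩
    𝟙 ⌊ AgreeAt? X Y z ⌋ ∎) (agreeAt-refl X)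
    where open ≡-Reasoning

  disagreeAt⇒p-differs : (X Y : LinOrd n) {z : Fin n} → ¬ AgreeAt X Y z →
                         ∃ λ S → z ∈ S × p X z S ≢ p Y z S
  disagreeAt⇒p-differs X Y {z} ¬agree with anySubset? (λ S → (z ∈? S) ×-dec ¬? (p X z S ℚ.≟ p Y z S))
  ... | yes differs = differs
  ... | no ¬differs = contradiction (p-row-determines-agreeAt X Y z rows≡) ¬agree
    where
    rows≡ : ∀ S → z ∈ S → p X z S ≡ p Y z S
    rows≡ S z∈ = decidable-stable (p X z S ℚ.≟ p Y z S) λ ≢ → ¬differs (S , z∈ , ≢)

module _ {n : ℕ} (L L' : LinOrd n) where

  objective : QVec n
  objective = möbius L ⊕ möbius L'

  optimum : ℚ
  optimum = dot objective (p L)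

  score : LinOrd n → Fin n → ℚ
  score M i = 𝟙 ⌊ AgreeAt? L M i ⌋ + 𝟙 ⌊ AgreeAt? L' M i ⌋

  dot-objective : (M : LinOrd n) → dot objective (p M) ≡ ∑ (score M) (allFin n)
  dot-objective M = trans (dot-⊕ˡ (möbius L) (möbius L') (p M))
    (trans (cong₂ _+_ (dot-möbius-p L M) (dot-möbius-p L' M)) (sym (∑-distrib-+ _ _ (allFin n))))

  score-L : ∀ i → score L i ≡ 1ℚ + 𝟙 ⌊ AgreeAt? L' L i ⌋
  score-L i = cong (_+ 𝟙 ⌊ AgreeAt? L' L i ⌋) (𝟙-true (AgreeAt? L L i) (agreeAt-refl L))

  score-≤ : (M : LinOrd n) → ∀ i → score M i ≤ score L i
  score-≤ M i = subst (score M i ≤_) (sym (score-L i))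
    (𝟙-+-≤ (AgreeAt? L M i) (AgreeAt? L' M i) (AgreeAt? L' L i) λ a a' → agreeAt-trans a' (agreeAt-sym a))

  score-L' : ∀ i → score L' i ≡ score L i
  score-L' i = begin
    𝟙 ⌊ AgreeAt? L L' i ⌋ + 𝟙 ⌊ AgreeAt? L' L' i ⌋
      ≡⟨ cong (𝟙 ⌊ AgreeAt? L L' i ⌋ +_) (𝟙-true (AgreeAt? L' L' i) (agreeAt-refl L')) ⟩
    𝟙 ⌊ AgreeAt? L L' i ⌋ + 1ℚ
      ≡⟨ ℚ.+-comm (𝟙 ⌊ AgreeAt? L L' i ⌋) 1ℚ ⟩
    1ℚ + 𝟙 ⌊ AgreeAt? L L' i ⌋
      ≡⟨ cong (λ b → 1ℚ + 𝟙 b) (⌊⌋-⇔ (mk⇔ agreeAt-sym agreeAt-sym) (AgreeAt? L L' i) (AgreeAt? L' L i)) ⟩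
    1ℚ + 𝟙 ⌊ AgreeAt? L' L i ⌋
      ≡⟨ sym (score-L i) ⟩
    score L i ∎
    where open ≡-Reasoning

  objective-≤ : (M : LinOrd n) → dot objective (p M) ≤ optimum
  objective-≤ M = subst₂ _≤_ (sym (dot-objective M)) (sym (dot-objective L))
    (∑-mono-≤ (All.universal (score-≤ M) (allFin n)))

  objective-L' : dot objective (p L') ≡ optimum
  objective-L' = trans (dot-objective L') (trans (∑-cong (allFin n) score-L') (sym (dot-objective L)))

  objective-optimal : (M : LinOrd n) → dot objective (p M) ≡ optimum →
                      ∀ i → AgreeAt L M i ⊎ AgreeAt L' M i
  objective-optimal M eq i = 𝟙-+-≡ (AgreeAt? L M i) (AgreeAt? L' M i) (AgreeAt? L' L i)
    (trans (All.lookup scores≡ (∈-allFin i)) (score-L i))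
    where
    scores≡ : All (λ i → score M i ≡ score L i) (allFin n)
    scores≡ = ∑-≤-≡⇒≡ (All.universal (score-≤ M) (allFin n))
      (trans (sym (dot-objective M)) (trans eq (dot-objective L)))

-- Adjacency

module _ {n : ℕ} (L L' : LinOrd n) where

  InCone : QVec n → ℚ → Set
  InCone x total = Σ ℚ λ t → Σ ℚ λ s →
    0ℚ ≤ t × 0ℚ ≤ s × t + s ≡ total × x ≈E (scale t (p L) ⊕ scale s (p L'))

  ScaledEndpoint : ℚ × LinOrd n → Set
  ScaledEndpoint (w , M) = scale w (p M) ≈E scale w (p L) ⊎ scale w (p M) ≈E scale w (p L')

  combination-inCone : (ws : List (ℚ × LinOrd n)) → All (λ w → 0ℚ ≤ proj₁ w) ws → All ScaledEndpoint ws →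
                       InCone (combination ws) (∑ proj₁ ws)
  combination-inCone [] [] [] = 0ℚ , 0ℚ , ℚ.≤-refl , ℚ.≤-refl , refl , λ i S _ →
    sym (solve 2 (λ a b → con 0ℚ :* a :+ con 0ℚ :* b := con 0ℚ) refl (p L i S) (p L' i S))
  combination-inCone ((w , M) ∷ ws) (0≤w ∷ 0≤ws) (at-end ∷ at-ends)
    with combination-inCone ws 0≤ws at-ends
  ... | t , s , 0≤t , 0≤s , t+s≡ , ≈cone with at-end
  ...   | inj₁ ≈L  = w + t , s , ℚ.+-mono-≤ 0≤w 0≤t , 0≤s ,
    trans (ℚ.+-assoc w t s) (cong (w +_) t+s≡) ,
    λ i S i∈ → trans (cong₂ _+_ (≈L i S i∈) (≈cone i S i∈))
      (solve 5 (λ w t s a b → w :* a :+ (t :* a :+ s :* b) := (w :+ t) :* a :+ s :* b)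
             refl w t s (p L i S) (p L' i S))
  ...   | inj₂ ≈L' = t , w + s , 0≤t , ℚ.+-mono-≤ 0≤w 0≤s ,
    trans (solve 3 (λ w t s → t :+ (w :+ s) := w :+ (t :+ s)) refl w t s) (cong (w +_) t+s≡) ,
    λ i S i∈ → trans (cong₂ _+_ (≈L' i S i∈) (≈cone i S i∈))
      (solve 5 (λ w t s a b → w :* b :+ (t :* a :+ s :* b) := t :* a :+ (w :+ s) :* b)
             refl w t s (p L i S) (p L' i S))

  inCone⇒inSegment : ∀ {x} → InCone x 1ℚ → InSegment L L' x
  inCone⇒inSegment (t , s , 0≤t , 0≤s , t+s≡1 , ≈cone) =
    t , 0≤t , t≤1 , λ i S i∈ → trans (≈cone i S i∈) (cong (λ r → t * p L i S + r * p L' i S) s≡1-t)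
    where
    s≡1-t : s ≡ 1ℚ - t
    s≡1-t = trans (solve 2 (λ t s → s := (t :+ s) :- t) refl t s) (cong (_- t) t+s≡1)
    t≤1 : t ≤ 1ℚ
    t≤1 = subst (t ≤_) t+s≡1 (subst (_≤ t + s) (ℚ.+-identityʳ t) (ℚ.+-monoʳ-≤ t 0≤s))

  private
    c = objective L L'
    d = optimum L L'

  dot-convex : ∀ {x ws} → x ≈E combination ws → dot c x ≡ ∑ (λ w → proj₁ w * dot c (p (proj₂ w))) ws
  dot-convex {x} {ws} x≈ = trans (dot-cong c x≈) (dot-combination c ws)

  weighted-≤ : ∀ {ws : List (ℚ × LinOrd n)} → All (λ w → 0ℚ ≤ proj₁ w) ws →
               All (λ w → proj₁ w * dot c (p (proj₂ w)) ≤ proj₁ w * d) ws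
  weighted-≤ {[]}          []            = []
  weighted-≤ {(w , M) ∷ _} (0≤w ∷ 0≤ws) =
    ℚ.*-monoˡ-≤-nonNeg w {{nonNegative 0≤w}} (objective-≤ L L' M) ∷ weighted-≤ 0≤ws

  ∑-weights : (ws : List (ℚ × LinOrd n)) → ∑ proj₁ ws ≡ 1ℚ → ∑ (λ w → proj₁ w * d) ws ≡ d
  ∑-weights ws total≡1 = begin
    ∑ (λ w → proj₁ w * d) ws ≡⟨ ∑-cong ws (λ w → ℚ.*-comm (proj₁ w) d) ⟩
    ∑ (λ w → d * proj₁ w) ws ≡⟨ ∑-distribˡ-* d proj₁ ws ⟩
    d * ∑ proj₁ ws           ≡⟨ cong (d *_) total≡1 ⟩
    d * 1ℚ                   ≡⟨ ℚ.*-identityʳ d ⟩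
    d                        ∎
    where open ≡-Reasoning

  objective-valid : ∀ x → InPMC x → dot c x ≤ d
  objective-valid x (ws , 0≤ws , total≡1 , x≈) =
    subst₂ _≤_ (sym (dot-convex {x} {ws} x≈)) (∑-weights ws total≡1) (∑-mono-≤ (weighted-≤ 0≤ws))

  segment⇒face : ∀ x → InSegment L L' x → dot c x ≡ d
  segment⇒face x (t , _ , _ , x≈) = begin
    dot c x
      ≡⟨ dot-cong c x≈ ⟩
    dot c (scale t (p L) ⊕ scale (1ℚ - t) (p L'))
      ≡⟨ dot-⊕ʳ c _ _ ⟩
    dot c (scale t (p L)) + dot c (scale (1ℚ - t) (p L'))
      ≡⟨ cong₂ _+_ (dot-scale c t (p L)) (dot-scale c (1ℚ - t) (p L')) ⟩
    t * d + (1ℚ - t) * dot c (p L')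
      ≡⟨ cong (λ e → t * d + (1ℚ - t) * e) (objective-L' L L') ⟩
    t * d + (1ℚ - t) * d
      ≡⟨ solve 2 (λ t d → t :* d :+ (con 1ℚ :- t) :* d := d) refl t d ⟩
    d ∎
    where open ≡-Reasoning

  module _ (¬condB : ¬ CondB L L') where

    optimal-vertex : ∀ M → dot c (p M) ≡ d → p M ≈E p L ⊎ p M ≈E p L'
    optimal-vertex M opt =
      Sum.map (λ agree i S _ → p-agreeAt L M (agree i) S) (λ agree i S _ → p-agreeAt L' M (agree i) S)
              (agreeAt-everywhere L L' M ¬condB (objective-optimal L L' M opt))

    weight-at-end : ∀ {w M} → w ≡ 0ℚ ⊎ dot c (p M) ≡ d → ScaledEndpoint (w , M)
    weight-at-end {w} {M} (inj₁ w≡0) = inj₁ λ i S _ → trans (cong (_* p M i S) w≡0)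
      (trans (ℚ.*-zeroˡ (p M i S)) (sym (trans (cong (_* p L i S) w≡0) (ℚ.*-zeroˡ (p L i S)))))
    weight-at-end {w} {M} (inj₂ opt) = Sum.map scale-cong scale-cong (optimal-vertex M opt)
      where
      scale-cong : ∀ {x y} → x ≈E y → scale w x ≈E scale w y
      scale-cong x≈y i S i∈ = cong (w *_) (x≈y i S i∈)

    face-weights : ∀ {x ws} → All (λ w → 0ℚ ≤ proj₁ w) ws → ∑ proj₁ ws ≡ 1ℚ → x ≈E combination ws →
                   dot c x ≡ d → All ScaledEndpoint ws
    face-weights {x} {ws} 0≤ws total≡1 x≈ opt = at-ends 0≤ws tight
      where
      tight : All (λ w → proj₁ w * dot c (p (proj₂ w)) ≡ proj₁ w * d) ws
      tight = ∑-≤-≡⇒≡ (weighted-≤ 0≤ws)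
        (trans (sym (dot-convex {x} {ws} x≈)) (trans opt (sym (∑-weights ws total≡1))))
      at-ends : ∀ {vs} → All (λ w → 0ℚ ≤ proj₁ w) vs →
                All (λ w → proj₁ w * dot c (p (proj₂ w)) ≡ proj₁ w * d) vs → All ScaledEndpoint vs
      at-ends {[]}          []           []               = []
      at-ends {(w , M) ∷ _} (0≤w ∷ 0≤vs) (tight-w ∷ tight) =
        weight-at-end {w} {M} (nonNeg-*-≡ 0≤w (objective-≤ L L' M) tight-w) ∷ at-ends 0≤vs tight

    face⇒segment : ∀ x → InPMC x → dot c x ≡ d → InSegment L L' x
    face⇒segment x (ws , 0≤ws , total≡1 , x≈) opt
      with combination-inCone ws 0≤ws (face-weights {x} {ws} 0≤ws total≡1 x≈ opt)
    ... | t , s , 0≤t , 0≤s , t+s≡ , ≈cone = inCone⇒inSegment {x}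
      (t , s , 0≤t , 0≤s , trans t+s≡ total≡1 , λ i S i∈ → trans (x≈ i S i∈) (≈cone i S i∈))

    ¬condB⇒adjacent : Adjacent L L'
    ¬condB⇒adjacent = c , d , objective-valid , λ x x∈ → mk⇔ (face⇒segment x x∈) (segment⇒face x)

-- Non-adjacency

segment-coordinate-first : ∀ a b {t} → 𝟙 a ≢ 𝟙 b → 𝟙 a ≡ t * 𝟙 a + (1ℚ - t) * 𝟙 b → t ≡ 1ℚ
segment-coordinate-first true  true  a≢b _ = contradiction refl a≢b
segment-coordinate-first false false a≢b _ = contradiction refl a≢b
segment-coordinate-first true  false {t} _ eq =
  trans (solve 1 (λ t → t := t :* con 1ℚ :+ (con 1ℚ :- t) :* con 0ℚ) refl t) (sym eq)
segment-coordinate-first false true  {t} _ eq =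
  trans (solve 1 (λ t → t := con 1ℚ :- (t :* con 0ℚ :+ (con 1ℚ :- t) :* con 1ℚ)) refl t)
        (cong (λ q → 1ℚ - q) (sym eq))

segment-coordinate-second : ∀ a b {t} → 𝟙 a ≢ 𝟙 b → 𝟙 b ≡ t * 𝟙 a + (1ℚ - t) * 𝟙 b → t ≡ 0ℚ
segment-coordinate-second true  true  a≢b _ = contradiction refl a≢b
segment-coordinate-second false false a≢b _ = contradiction refl a≢b
segment-coordinate-second true  false {t} _ eq =
  trans (solve 1 (λ t → t := t :* con 1ℚ :+ (con 1ℚ :- t) :* con 0ℚ) refl t) (sym eq)
segment-coordinate-second false true  {t} _ eq =
  trans (solve 1 (λ t → t := con 1ℚ :- (t :* con 0ℚ :+ (con 1ℚ :- t) :* con 1ℚ)) refl t)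
        (cong (λ q → 1ℚ - q) (sym eq))

0≤½ : 0ℚ ≤ ½
0≤½ = from-yes (0ℚ ℚ.≤? ½)

module _ {n : ℕ} where

  midpoint : LinOrd n → LinOrd n → QVec n
  midpoint M M' = combination ((½ , M) ∷ (½ , M') ∷ [])

  vertex-in-PMC : (M : LinOrd n) → InPMC (p M)
  vertex-in-PMC M = (1ℚ , M) ∷ [] , ℚ.<⇒≤ 0<1 ∷ [] , refl , λ i S _ →
    sym (trans (ℚ.+-identityʳ (1ℚ * p M i S)) (ℚ.*-identityˡ (p M i S)))

  midpoint-in-PMC : (M M' : LinOrd n) → InPMC (midpoint M M')
  midpoint-in-PMC M M' = (½ , M) ∷ (½ , M') ∷ [] , 0≤½ ∷ 0≤½ ∷ [] , refl , λ _ _ _ → refl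

  tight-at-midpoint : (c : QVec n) (d : ℚ) → (∀ x → InPMC x → dot c x ≤ d) →
                      ∀ M M' → dot c (midpoint M M') ≡ d → dot c (p M) ≡ d
  tight-at-midpoint c d valid M M' tight =
    [ (λ ()) , id ]′ (nonNeg-*-≡ 0≤½ (valid (p M) (vertex-in-PMC M)) half-tight)
    where
    half-≤ : ∀ X → ½ * dot c (p X) ≤ ½ * d
    half-≤ X = ℚ.*-monoˡ-≤-nonNeg ½ (valid (p X) (vertex-in-PMC X))
    halves : ½ * dot c (p M) + (½ * dot c (p M') + 0ℚ) ≡ ½ * d + (½ * d + 0ℚ)
    halves = trans (sym (dot-combination c ((½ , M) ∷ (½ , M') ∷ [])))
               (trans tight (solve 1 (λ d → d := con ½ :* d :+ (con ½ :* d :+ con 0ℚ)) refl d))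
    half-tight : ½ * dot c (p M) ≡ ½ * d
    half-tight = proj₁ (+-≤-≡⇒≡ (half-≤ M) (ℚ.+-monoˡ-≤ 0ℚ (half-≤ M')) halves)

  glue-midpoint : (L L' : LinOrd n) (U : Subset n) → Separated L U → Separated L' U →
                  midpoint (glue L L' U) (glue L' L U) ≈E (scale ½ (p L) ⊕ scale (1ℚ - ½) (p L'))
  glue-midpoint L L' U sepL sepL' i S _ = by-side (i ∈? U)
    where
    M = glue L L' U
    M' = glue L' L U
    by-side : Dec (i ∈ U) → ½ * p M i S + (½ * p M' i S + 0ℚ) ≡ ½ * p L i S + (1ℚ - ½) * p L' i S
    by-side (yes i∈U) = trans
      (cong₂ (λ a b → ½ * a + (½ * b + 0ℚ)) (p-agreeAt L M (glue-agreeAt-inside L L' U sepL i∈U) S)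
                                           (p-agreeAt L' M' (glue-agreeAt-inside L' L U sepL' i∈U) S))
      (solve 2 (λ a b → con ½ :* a :+ (con ½ :* b :+ con 0ℚ) := con ½ :* a :+ (con 1ℚ :- con ½) :* b)
             refl (p L i S) (p L' i S))
    by-side (no i∉U) = trans
      (cong₂ (λ a b → ½ * a + (½ * b + 0ℚ)) (p-agreeAt L' M (glue-agreeAt-outside L L' U sepL' i∉U) S)
                                           (p-agreeAt L M' (glue-agreeAt-outside L' L U sepL i∉U) S))
      (solve 2 (λ a b → con ½ :* b :+ (con ½ :* a :+ con 0ℚ) := con ½ :* a :+ (con 1ℚ :- con ½) :* b)
             refl (p L i S) (p L' i S))

  condB⇒¬adjacent : (L L' : LinOrd n) → CondB L L' → ¬ Adjacent L L'
  condB⇒¬adjacent L L' (U , _ , _ , (beginL , beginL') , (¬coincide-inside , ¬coincide-outside))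
                       (c , d , valid , face)
    with ¬coincide⇒disagreeAt L L' ¬coincide-inside | ¬coincide⇒disagreeAt L L' ¬coincide-outside
  ... | z , z∈U , ¬agree-z | z' , z'∈∁U , ¬agree-z'
    with disagreeAt⇒p-differs L L' ¬agree-z | disagreeAt⇒p-differs L L' ¬agree-z'
  ... | S , z∈S , differs | S' , z'∈S' , differs' = contradiction (trans (sym t≡0) t≡1) (λ ())
    where
    sepL = beginning⇒separated L beginL
    sepL' = beginning⇒separated L' beginL'
    M = glue L L' U
    midpoint-on-segment : InSegment L L' (midpoint M (glue L' L U))
    midpoint-on-segment = ½ , 0≤½ , from-yes (½ ℚ.≤? 1ℚ) , glue-midpoint L L' U sepL sepL'
    M-on-segment : InSegment L L' (p M)
    M-on-segment = to (face (p M) (vertex-in-PMC M)) (tight-at-midpoint c d valid M (glue L' L U)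
      (from (face _ (midpoint-in-PMC M (glue L' L U))) midpoint-on-segment))
    t = proj₁ M-on-segment
    p-M≈ = proj₂ (proj₂ (proj₂ M-on-segment))
    t≡1 : t ≡ 1ℚ
    t≡1 = segment-coordinate-first _ _ differs
      (trans (sym (p-agreeAt L M (glue-agreeAt-inside L L' U sepL z∈U) S)) (p-M≈ z S z∈S))
    t≡0 : t ≡ 0ℚ
    t≡0 = segment-coordinate-second _ _ differs'
      (trans (sym (p-agreeAt L' M (glue-agreeAt-outside L L' U sepL' (x∈∁p⇒x∉p z'∈∁U)) S'))
             (p-M≈ z' S' z'∈S'))

condA? : {n : ℕ} (L L' : LinOrd n) → Dec (CondA L L')
condA? L L' = any? λ i → any? λ j → any? λ k →
  ((i >[ L ]? k) ×-dec (j >[ L ]? k) ×-dec (i >[ L' ]? k) ×-dec (j >[ L' ]? k)) ×-dec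
  ¬? (i ≟ j) ×-dec ¬? (L⁻ L k ≟ₛ L⁻ L' k) ×-dec (L⁻ L i ≟ₛ L⁻ L' j)
  where
  _≟ₛ_ = Vec.≡-dec Data.Bool._≟_

proposition8 : (n : ℕ) (L L' : LinOrd n) →
    (CondA L L' ⇔ CondB L L') × (CondB L L' ⇔ CondC L L')
proposition8 n L L' =
  mk⇔ (condA⇒condB L L') (condB⇒condA L L') , mk⇔ (condB⇒¬adjacent L L') condC⇒condB
  where
  condC⇒condB : CondC L L' → CondB L L'
  condC⇒condB ¬adjacent with condA? L L'
  ... | yes condA = condA⇒condB L L' condA
  ... | no ¬condA = contradiction (¬condB⇒adjacent L L' (¬condA ∘ condB⇒condA L L')) ¬adjacent
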